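{- Let $t_n=(-1)^{s_2(n)}$, $h_0=0$, $h_1=1$, and $h_n=t_nh_{n-1}+h_{n-2}$ for $n\ge2$. Let $n\ge 5$ be an integer. Then the regular continued fraction expansion of $|h_n|/|h_{n-1}|$ has the form $[a(n);\varepsilon_1(n),\ldots,\varepsilon_{k_n}(n)]$ where $a(n)\in\{0,1,2,3,4\}$ and $\varepsilon_i(n)\in\{1,2,3\}$ for each $i\in\{1,\ldots,k_n\}$.
   Context: $s_2(n)$ denotes the number of 1's in the binary expansion of $n$; $(t_n)$ is the Prouhet–Thue–Morse sequence. $[a_0;a_1,\ldots,a_k]=a_0+1/[a_1;\ldots,a_k]$ with $[a_0]=a_0$; regular means $a_0\in\mathbb{N}$ and $a_i\in\mathbb{N}_{+}$ for $i\ge1$. -}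

module Defs where

open import Data.Nat using (ℕ; zero; suc; _+_; _*_; _/_; _%_)
open import Data.Integer as ℤ using (ℤ; +_; -_)
open import Data.Product using (_×_; _,_; proj₁; proj₂)
open import Data.List using (List; []; _∷_)

-- s₂ n : number of 1's in the binary expansion of n.
-- Computed with fuel; fuel n suffices since n has at most n binary digits.
s₂-fuel : ℕ → ℕ → ℕ
s₂-fuel zero    n = 0
s₂-fuel (suc f) n = n % 2 + s₂-fuel f (n / 2)

s₂ : ℕ → ℕ
s₂ n = s₂-fuel n n

neg1^ : ℕ → ℤ
neg1^ zero    = + 1
neg1^ (suc k) = - neg1^ k

t : ℕ → ℤ
t n = neg1^ (s₂ n)

-- hpair n = (h n , h (n+1)), with h 0 = 0, h 1 = 1, h n = t n * h (n-1) + h (n-2)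
hpair : ℕ → ℤ × ℤ
hpair zero    = (+ 0 , + 1)
hpair (suc n) = let p = hpair n in
  (proj₂ p , t (suc (suc n)) ℤ.* proj₂ p ℤ.+ proj₁ p)

h : ℕ → ℤ
h n = proj₁ (hpair n)

-- Value of the finite continued fraction [a₀; a₁, …, a_k] as a pair
-- (numerator , denominator) of naturals, by the usual recursion
-- [a₀] = a₀/1,  [a₀; a₁,…,a_k] = a₀ + 1/[a₁;…,a_k] = (a₀ p + q)/p  where [a₁;…] = p/q.
cf : ℕ → List ℕ → ℕ × ℕ
cf a []       = (a , 1)
cf a (b ∷ bs) = let r = cf b bs in (a * proj₁ r + proj₂ r , proj₁ r)

{-# OPTIONS --safe #-}
module Submission where

-- Put w n = t n h n / h (n − 1) and c n = t n t (n + 1).  Then |w n| = |h n| / |h (n − 1)| and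
-- w (n + 1) = 1 + c n / w n.  From t (2k) = t k and t (2k + 1) = − t k we get c (2k) = −1 and
-- c (2k + 1) = − c k, hence c (4m + 4) = −1, c (4m + 5) = 1 and c (4m + 6) = −1, while c (4m + 3)
-- can be either sign.  Let u = 1 / |w (4m + 3)|.  If u is [2; …], [3; …] or [1; 1, …] with all
-- later partial quotients in {1, 2, 3}, then following the four steps of the block in both cases
-- of c (4m + 3) shows that |w (4m + 4)|, |w (4m + 5)|, |w (4m + 6)| (like |w (4m + 3)| = [0; u])
-- have first partial quotient at most 4 and later ones in {1, 2, 3}, and that 1 / |w (4m + 7)| is
-- again of the form of u.  This holds for m = 1, and n = 5, 6 are checked directly.

open import Defs
open import Data.Nat using (ℕ; zero; suc; _+_; _*_; _∸_; _≤_; _/_; _%_; z≤n; s≤s; s≤s⁻¹; NonZero)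
open import Data.Nat.Properties
  using (≤-refl; ≤-trans; <-≤-trans; m≤m+n; m≤n⇒m≤1+n; m≤n⇒∃[o]m+o≡n; m<n⇒n≢0; +-assoc; +-comm;
         *-identityʳ; *-distribʳ-+; *-mono-≤)
open import Data.Nat.DivMod using (m/n<m; m*n/n≡m; m*n%n≡0; [m+kn]%n≡m%n; +-distrib-/-∣ʳ; _divMod_; result)
open import Data.Nat.Divisibility using (n∣m*n)
open import Data.Integer as ℤ using (ℤ; +_; ∣_∣; 1ℤ; -1ℤ)
open import Data.Integer.Properties as ℤP using (pos-+; -1*i≡-i; ∣-i∣≡∣i∣)
open import Data.Integer.Tactic.RingSolver using (solve-∀)
import Data.Nat.Tactic.RingSolver as ℕ-Solver
open import Data.Fin using (Fin; toℕ; zero; suc)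
open import Data.Product using (Σ; _×_; _,_; proj₁; proj₂; swap)
open import Data.Sum using (_⊎_; inj₁; inj₂)
open import Data.List using (List; []; _∷_)
open import Data.List.Relation.Unary.All as All using (All; []; _∷_)
open import Function using (_∘_)
open import Relation.Binary.PropositionalEquality
  using (_≡_; _≢_; refl; sym; trans; cong; cong₂; subst; module ≡-Reasoning)

open ≡-Reasoning

half-≤ : ∀ {n f} → n ≤ suc f → n / 2 ≤ f
half-≤ {zero}  _   = z≤n
half-≤ {suc n} n≤f = s≤s⁻¹ (<-≤-trans (m/n<m (suc n) 2 (s≤s (s≤s z≤n))) n≤f)

s₂-fuel-zero : ∀ f → s₂-fuel f 0 ≡ 0
s₂-fuel-zero zero    = refl
s₂-fuel-zero (suc f) = s₂-fuel-zero f

s₂-fuel-irrelevant : ∀ {f g n} → n ≤ f → n ≤ g → s₂-fuel f n ≡ s₂-fuel g n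
s₂-fuel-irrelevant {zero}  {g}     z≤n _   = sym (s₂-fuel-zero g)
s₂-fuel-irrelevant {suc f} {zero}  _   z≤n = s₂-fuel-zero (suc f)
s₂-fuel-irrelevant {suc f} {suc g} {n} n≤f n≤g =
  cong (_+_ (n % 2)) (s₂-fuel-irrelevant (half-≤ n≤f) (half-≤ n≤g))

s₂-unfold : ∀ n .{{_ : NonZero n}} → s₂ n ≡ n % 2 + s₂ (n / 2)
s₂-unfold (suc n) = cong (_+_ (suc n % 2)) (s₂-fuel-irrelevant {n} (half-≤ {suc n} ≤-refl) ≤-refl)

s₂-double : ∀ k → s₂ (k * 2) ≡ s₂ k
s₂-double zero    = refl
s₂-double (suc k) = begin
  s₂ (suc k * 2)                      ≡⟨ s₂-unfold (suc k * 2) ⟩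
  suc k * 2 % 2 + s₂ (suc k * 2 / 2)  ≡⟨ cong₂ (λ r q → r + s₂ q) (m*n%n≡0 (suc k) 2) (m*n/n≡m (suc k) 2) ⟩
  s₂ (suc k)                          ∎

s₂-double+1 : ∀ k → s₂ (1 + k * 2) ≡ 1 + s₂ k
s₂-double+1 k = begin
  s₂ (1 + k * 2)                            ≡⟨ s₂-unfold (1 + k * 2) ⟩
  (1 + k * 2) % 2 + s₂ ((1 + k * 2) / 2)    ≡⟨ cong₂ (λ r q → r + s₂ q) ([m+kn]%n≡m%n 1 k 2) half ⟩
  1 + s₂ k                                  ∎
  where
  half : (1 + k * 2) / 2 ≡ k
  half = trans (+-distrib-/-∣ʳ 1 {d = 2} (n∣m*n k)) (m*n/n≡m k 2)

t-double : ∀ k → t (k * 2) ≡ t k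
t-double k = cong neg1^ (s₂-double k)

t-double+1 : ∀ k → t (1 + k * 2) ≡ ℤ.- t k
t-double+1 k = cong neg1^ (s₂-double+1 k)

IsSign : ℤ → Set
IsSign s = s ≡ 1ℤ ⊎ s ≡ -1ℤ

neg1^-sign : ∀ k → IsSign (neg1^ k)
neg1^-sign zero = inj₁ refl
neg1^-sign (suc k) with neg1^-sign k
... | inj₁ p = inj₂ (cong ℤ.-_ p)
... | inj₂ p = inj₁ (cong ℤ.-_ p)

t-sign : ∀ n → IsSign (t n)
t-sign n = neg1^-sign (s₂ n)

sign-* : ∀ {a b} → IsSign a → IsSign b → IsSign (a ℤ.* b)
sign-* (inj₁ refl) (inj₁ refl) = inj₁ refl
sign-* (inj₁ refl) (inj₂ refl) = inj₂ refl
sign-* (inj₂ refl) (inj₁ refl) = inj₂ refl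
sign-* (inj₂ refl) (inj₂ refl) = inj₁ refl

sign-neg : ∀ {a} → IsSign a → IsSign (ℤ.- a)
sign-neg (inj₁ refl) = inj₂ refl
sign-neg (inj₂ refl) = inj₁ refl

sign-square : ∀ {s} → IsSign s → s ℤ.* s ≡ 1ℤ
sign-square (inj₁ refl) = refl
sign-square (inj₂ refl) = refl

sign-cancel : ∀ {s} → IsSign s → ∀ x → s ℤ.* (s ℤ.* x) ≡ x
sign-cancel {s} s± x = begin
  s ℤ.* (s ℤ.* x)  ≡⟨ ℤP.*-assoc s s x ⟨
  s ℤ.* s ℤ.* x    ≡⟨ cong (ℤ._* x) (sign-square s±) ⟩
  1ℤ ℤ.* x         ≡⟨ ℤP.*-identityˡ x ⟩
  x                ∎

sign-abs : ∀ {s} → IsSign s → ∀ x → ∣ s ℤ.* x ∣ ≡ ∣ x ∣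
sign-abs (inj₁ refl) x = cong ∣_∣ (ℤP.*-identityˡ x)
sign-abs (inj₂ refl) x = trans (cong ∣_∣ (-1*i≡-i x)) (∣-i∣≡∣i∣ x)

-- turn n is the sign c n of the header.
turn : ℕ → ℤ
turn n = t n ℤ.* t (suc n)

turn-sign : ∀ n → IsSign (turn n)
turn-sign n = sign-* (t-sign n) (t-sign (suc n))

turn-double : ∀ k → turn (k * 2) ≡ -1ℤ
turn-double k = begin
  t (k * 2) ℤ.* t (1 + k * 2)  ≡⟨ cong₂ ℤ._*_ (t-double k) (t-double+1 k) ⟩
  t k ℤ.* ℤ.- t k              ≡⟨ ℤP.neg-distribʳ-* (t k) (t k) ⟨
  ℤ.- (t k ℤ.* t k)            ≡⟨ cong ℤ.-_ (sign-square (t-sign k)) ⟩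
  -1ℤ                          ∎

turn-double+1 : ∀ k → turn (1 + k * 2) ≡ ℤ.- turn k
turn-double+1 k = begin
  t (1 + k * 2) ℤ.* t (suc k * 2)  ≡⟨ cong₂ ℤ._*_ (t-double+1 k) (t-double (suc k)) ⟩
  ℤ.- t k ℤ.* t (suc k)            ≡⟨ ℤP.neg-distribˡ-* (t k) (t (suc k)) ⟨
  ℤ.- turn k                       ∎

turn[4+4m]≡-1 : ∀ m → turn (4 + m * 2 * 2) ≡ -1ℤ
turn[4+4m]≡-1 m = turn-double (2 + m * 2)

turn[5+4m]≡1 : ∀ m → turn (5 + m * 2 * 2) ≡ 1ℤ
turn[5+4m]≡1 m = trans (turn-double+1 (2 + m * 2)) (cong ℤ.-_ (turn-double (suc m)))

turn[6+4m]≡-1 : ∀ m → turn (6 + m * 2 * 2) ≡ -1ℤ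
turn[6+4m]≡-1 m = turn-double (3 + m * 2)

infix 4 _≈±_

record _≈±_ (u v : ℤ × ℤ) : Set where
  constructor signed
  field
    sign    : ℤ
    is-sign : IsSign sign
    fst≡    : proj₁ u ≡ sign ℤ.* proj₁ v
    snd≡    : proj₂ u ≡ sign ℤ.* proj₂ v

≈±-reflexive : ∀ {x y X Y} → x ≡ X → y ≡ Y → (x , y) ≈± (X , Y)
≈±-reflexive {X = X} {Y} refl refl =
  signed 1ℤ (inj₁ refl) (sym (ℤP.*-identityˡ X)) (sym (ℤP.*-identityˡ Y))

≈±-trans : ∀ {u v w} → u ≈± v → v ≈± w → u ≈± w
≈±-trans {w = X , Y} (signed σ σ± x≡ y≡) (signed τ τ± x′≡ y′≡) =
  signed (σ ℤ.* τ) (sign-* σ± τ±) (rescale x≡ x′≡) (rescale y≡ y′≡)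
  where
  rescale : ∀ {a b c} → a ≡ σ ℤ.* b → b ≡ τ ℤ.* c → a ≡ σ ℤ.* τ ℤ.* c
  rescale {c = c} refl refl = sym (ℤP.*-assoc σ τ c)

≈±-neg : ∀ {x y v} → (x , y) ≈± v → (ℤ.- x , ℤ.- y) ≈± v
≈±-neg {v = X , Y} (signed σ σ± refl refl) =
  signed (ℤ.- σ) (sign-neg σ±) (ℤP.neg-distribˡ-* σ X) (ℤP.neg-distribˡ-* σ Y)

≈±-step : ∀ {τ₁ τ₂ h₀ h₁ X Y} → IsSign τ₁ → IsSign τ₂ → (τ₁ ℤ.* h₁ , h₀) ≈± (X , Y) →
          (τ₂ ℤ.* (τ₂ ℤ.* h₁ ℤ.+ h₀) , h₁) ≈± (X ℤ.+ τ₁ ℤ.* τ₂ ℤ.* Y , X)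
≈±-step {τ₁} {τ₂} {h₀} {h₁} {X} {Y} τ₁± τ₂± (signed σ σ± x≡ y≡) =
  signed (τ₁ ℤ.* σ) (sign-* τ₁± σ±) next≡ h₁≡
  where
  h₁≡ : h₁ ≡ τ₁ ℤ.* σ ℤ.* X
  h₁≡ = begin
    h₁                  ≡⟨ sign-cancel τ₁± h₁ ⟨
    τ₁ ℤ.* (τ₁ ℤ.* h₁)  ≡⟨ cong (τ₁ ℤ.*_) x≡ ⟩
    τ₁ ℤ.* (σ ℤ.* X)    ≡⟨ ℤP.*-assoc τ₁ σ X ⟨
    τ₁ ℤ.* σ ℤ.* X      ∎
  next≡ : τ₂ ℤ.* (τ₂ ℤ.* h₁ ℤ.+ h₀) ≡ τ₁ ℤ.* σ ℤ.* (X ℤ.+ τ₁ ℤ.* τ₂ ℤ.* Y)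
  next≡ = begin
    τ₂ ℤ.* (τ₂ ℤ.* h₁ ℤ.+ h₀)
      ≡⟨ ℤP.*-distribˡ-+ τ₂ (τ₂ ℤ.* h₁) h₀ ⟩
    τ₂ ℤ.* (τ₂ ℤ.* h₁) ℤ.+ τ₂ ℤ.* h₀
      ≡⟨ cong₂ ℤ._+_ (trans (sign-cancel τ₂± h₁) h₁≡) (cong (τ₂ ℤ.*_) y≡) ⟩
    τ₁ ℤ.* σ ℤ.* X ℤ.+ τ₂ ℤ.* (σ ℤ.* Y)
      ≡⟨ cong (ℤ._+_ (τ₁ ℤ.* σ ℤ.* X)) (sign-cancel τ₁± (τ₂ ℤ.* (σ ℤ.* Y))) ⟨
    τ₁ ℤ.* σ ℤ.* X ℤ.+ τ₁ ℤ.* (τ₁ ℤ.* (τ₂ ℤ.* (σ ℤ.* Y)))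
      ≡⟨ regroup τ₁ τ₂ σ X Y ⟩
    τ₁ ℤ.* σ ℤ.* (X ℤ.+ τ₁ ℤ.* τ₂ ℤ.* Y)
      ∎
    where
    regroup : ∀ a b s x y →
              a ℤ.* s ℤ.* x ℤ.+ a ℤ.* (a ℤ.* (b ℤ.* (s ℤ.* y))) ≡ a ℤ.* s ℤ.* (x ℤ.+ a ℤ.* b ℤ.* y)
    regroup = solve-∀

-- The moves w ↦ 1 + c / w on w = ± P / Q, by the sign of c w and by whether P ≥ Q.
infix 4 _⊢_↦_

data _⊢_↦_ : ℤ → ℤ × ℤ → ℤ × ℤ → Set where
  plus   : ∀ {P Q} → 1ℤ ⊢ (+ P , + Q) ↦ (+ (P + Q) , + P)
  minus≥ : ∀ {Q d} → -1ℤ ⊢ (+ (Q + d) , + Q) ↦ (+ d , + (d + Q))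
  minus≤ : ∀ {P d} → -1ℤ ⊢ (+ P , + (P + d)) ↦ (ℤ.- + d , + P)
  negate : ∀ {c X Y v} → c ⊢ (X , Y) ↦ v → ℤ.- c ⊢ (ℤ.- X , Y) ↦ v

↦-sound : ∀ {c X Y v} → c ⊢ (X , Y) ↦ v → (X ℤ.+ c ℤ.* Y , X) ≈± v
↦-sound (plus {P} {Q}) =
  ≈±-reflexive (trans (cong (ℤ._+_ (+ P)) (ℤP.*-identityˡ (+ Q))) (sym (pos-+ P Q))) refl
↦-sound (minus≥ {Q} {d}) =
  ≈±-reflexive (trans (cong (ℤ._+ -1ℤ ℤ.* + Q) (pos-+ Q d)) (cancel (+ Q) (+ d)))
               (cong +_ (+-comm Q d))
  where
  cancel : ∀ a b → a ℤ.+ b ℤ.+ -1ℤ ℤ.* a ≡ b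
  cancel = solve-∀
↦-sound (minus≤ {P} {d}) =
  ≈±-reflexive (trans (cong (λ x → + P ℤ.+ -1ℤ ℤ.* x) (pos-+ P d)) (cancel (+ P) (+ d))) refl
  where
  cancel : ∀ a b → a ℤ.+ -1ℤ ℤ.* (a ℤ.+ b) ≡ ℤ.- b
  cancel = solve-∀
↦-sound (negate {c} {X} {Y} step) =
  subst (_≈± _) (cong (_, ℤ.- X) negated) (≈±-neg (↦-sound step))
  where
  negated : ℤ.- (X ℤ.+ c ℤ.* Y) ≡ ℤ.- X ℤ.+ ℤ.- c ℤ.* Y
  negated = trans (ℤP.neg-distrib-+ X (c ℤ.* Y)) (cong (ℤ._+_ (ℤ.- X)) (ℤP.neg-distribˡ-* c Y))

inc : ℕ × ℕ → ℕ × ℕ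
inc (p , q) = q + p , q

cf-suc : ∀ a εs → cf (suc a) εs ≡ inc (cf a εs)
cf-suc a []       = refl
cf-suc a (b ∷ bs) = cong (_, p) (+-assoc p (a * p) (proj₂ (cf b bs)))
  where
  p : ℕ
  p = proj₁ (cf b bs)

cf-2∷ : ∀ b bs → cf 2 (b ∷ bs) ≡ inc (inc (swap (cf b bs)))
cf-2∷ b bs = trans (cf-suc 1 (b ∷ bs)) (cong inc (cf-suc 0 (b ∷ bs)))

cf-1∷1∷ : ∀ b bs → cf 1 (1 ∷ b ∷ bs) ≡ inc (swap (inc (swap (cf b bs))))
cf-1∷1∷ b bs = trans (cf-suc 0 (1 ∷ b ∷ bs)) (cong (inc ∘ swap) (cf-suc 0 (b ∷ bs)))

cf-merge : ∀ a b bs → cf a (0 ∷ b ∷ bs) ≡ cf (a + b) bs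
cf-merge a b []       = cong (λ x → x + b , 1) (*-identityʳ a)
cf-merge a b (c ∷ cs) =
  cong (_, p) (sym (trans (cong (_+ q) (*-distribʳ-+ p a b)) (+-assoc (a * p) (b * p) q)))
  where
  p q : ℕ
  p = proj₁ (cf c cs)
  q = proj₂ (cf c cs)

cf-merge-inner : ∀ a c b bs → cf a (c ∷ 0 ∷ b ∷ bs) ≡ cf a (c + b ∷ bs)
cf-merge-inner a c b bs = cong (λ p → a * proj₁ p + proj₂ p , proj₁ p) (cf-merge c b bs)

cf-numerator-pos : ∀ {b} bs → 1 ≤ b → All (1 ≤_) bs → 1 ≤ proj₁ (cf b bs)
cf-numerator-pos []       1≤b _             = 1≤b
cf-numerator-pos (c ∷ cs) 1≤b (1≤c ∷ 1≤cs) =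
  ≤-trans (*-mono-≤ 1≤b (cf-numerator-pos cs 1≤c 1≤cs)) (m≤m+n _ _)

cf-denominator-pos : ∀ a {εs} → All (1 ≤_) εs → 1 ≤ proj₂ (cf a εs)
cf-denominator-pos a {[]}     _            = s≤s z≤n
cf-denominator-pos a {b ∷ bs} (1≤b ∷ 1≤bs) = cf-numerator-pos bs 1≤b 1≤bs

Digit : ℕ → Set
Digit e = 1 ≤ e × e ≤ 3

digit-1 : Digit 1
digit-1 = s≤s z≤n , s≤s z≤n

digit-2 : Digit 2
digit-2 = s≤s z≤n , s≤s (s≤s z≤n)

record Tracks (n : ℕ) (v : ℤ × ℤ) : Set where
  constructor tracks
  field
    pair≈± : (t (suc n) ℤ.* h (suc n) , h n) ≈± v

tracks-step : ∀ {n X Y} → Tracks n (X , Y) → Tracks (suc n) (X ℤ.+ turn (suc n) ℤ.* Y , X)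
tracks-step {n} (tracks p) = tracks (≈±-step (t-sign (suc n)) (t-sign (suc (suc n))) p)

ratio : ℕ → ℕ × ℕ
ratio n = ∣ h (suc n) ∣ , ∣ h n ∣

tracks-ratio : ∀ {n X Y} → Tracks n (X , Y) → ratio n ≡ (∣ X ∣ , ∣ Y ∣)
tracks-ratio {n} (tracks (signed σ σ± x≡ y≡)) = cong₂ _,_
  (trans (sym (sign-abs (t-sign (suc n)) (h (suc n)))) (trans (cong ∣_∣ x≡) (sign-abs σ± _)))
  (trans (cong ∣_∣ y≡) (sign-abs σ± _))

tracks-next : ∀ {n c v v′} → Tracks n v → turn (suc n) ≡ c → c ⊢ v ↦ v′ → Tracks (suc n) v′
tracks-next tr refl step = tracks (≈±-trans (Tracks.pair≈± (tracks-step tr)) (↦-sound step))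

pos² : ℕ × ℕ → ℤ × ℤ
pos² (p , q) = + p , + q

record BoundedExpansion (n : ℕ) : Set where
  constructor expansion
  field
    a      : ℕ
    εs     : List ℕ
    a≤4    : a ≤ 4
    digits : All Digit εs
    ratio≡ : ratio n ≡ cf a εs

expansion⇒cross-equation : ∀ {n} → BoundedExpansion n →
  ∣ h n ∣ ≢ 0 ×
  Σ ℕ (λ a → Σ (List ℕ) (λ εs →
    a ≤ 4 × All Digit εs × ∣ h (suc n) ∣ * proj₂ (cf a εs) ≡ proj₁ (cf a εs) * ∣ h n ∣))
expansion⇒cross-equation {n} (expansion a εs a≤4 digits ratio≡) =
  nonzero , a , εs , a≤4 , digits , cong₂ _*_ (cong proj₁ ratio≡) (sym (cong proj₂ ratio≡))
  where
  nonzero : ∣ h n ∣ ≢ 0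
  nonzero = m<n⇒n≢0
    (subst (1 ≤_) (sym (cong proj₂ ratio≡)) (cf-denominator-pos a (All.map proj₁ digits)))

-- Admissible c r encodes u = [1 + c; r], of the form [2; r], [3; r] or [1; 1, r′].
data Admissible : ℕ → List ℕ → Set where
  head-2-3 : ∀ {c r} → 1 ≤ c → c ≤ 2 → All Digit r → Admissible c r
  head-1-1 : ∀ {r} → All Digit r → Admissible 0 (1 ∷ r)

admissible-head : ∀ {c r} → Admissible c r → Digit (suc c)
admissible-head (head-2-3 _ c≤2 _) = s≤s z≤n , s≤s c≤2
admissible-head (head-1-1 _)       = digit-1

admissible-tail : ∀ {c r} → Admissible c r → All Digit r
admissible-tail (head-2-3 _ _ ds) = ds
admissible-tail (head-1-1 ds)     = digit-1 ∷ ds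

-- Written m * 2 * 2 rather than m * 4 so that 4 + base m, 5 + base m, 6 + base m are
-- definitionally of the forms k * 2 and 1 + k * 2 used by turn-double and turn-double+1.
base : ℕ → ℕ
base m = 2 + m * 2 * 2

record Invariant (m : ℕ) : Set where
  constructor invariant
  field
    {c}        : ℕ
    {r}        : List ℕ
    admissible : Admissible c r
    state      : Tracks (base m) (pos² (swap (cf (suc c) r)))

invariant-expansion : ∀ {m} → Invariant m → BoundedExpansion (base m)
invariant-expansion (invariant {c} {r} adm st₀) =
  expansion 0 (suc c ∷ r) z≤n (admissible-head adm ∷ admissible-tail adm) (tracks-ratio st₀)

record BlockOutcome (m : ℕ) : Set where
  field
    expansion₁ : BoundedExpansion (1 + base m)
    expansion₂ : BoundedExpansion (2 + base m)
    expansion₃ : BoundedExpansion (3 + base m)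
    next       : Invariant (suc m)
positive-block : ∀ {m c r} → Admissible c r → Tracks (base m) (pos² (swap (cf (suc c) r))) →
                 turn (3 + m * 2 * 2) ≡ 1ℤ → BlockOutcome m
positive-block {m} {c} {r} adm st₀ turn≡1 = record
  { expansion₁ = expansion (suc (suc c)) r (s≤s (proj₂ dc)) ds
                   (trans (tracks-ratio st₁) (sym (cf-suc (suc c) r)))
  ; expansion₂ = expansion 0 (1 ∷ suc c ∷ r) z≤n (digit-1 ∷ dc ∷ ds)
                   (trans (tracks-ratio st₂) (cong swap (sym (cf-suc 0 (suc c ∷ r)))))
  ; expansion₃ = expansion 2 (suc c ∷ r) (s≤s (s≤s z≤n)) (dc ∷ ds)
                   (trans (tracks-ratio st₃) (sym (cf-2∷ (suc c) r)))
  ; next       = invariant (head-1-1 (dc ∷ ds))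
                   (subst (Tracks _) (cong (pos² ∘ swap) (sym (cf-1∷1∷ (suc c) r))) st₄)
  }
  where
  X Y : ℕ
  X = proj₁ (cf (suc c) r)
  Y = proj₂ (cf (suc c) r)
  dc : Digit (suc c)
  dc = admissible-head adm
  ds : All Digit r
  ds = admissible-tail adm
  st₁ : Tracks (1 + base m) (+ (Y + X) , + Y)
  st₁ = tracks-next st₀ turn≡1 plus
  st₂ : Tracks (2 + base m) (+ X , + (X + Y))
  st₂ = tracks-next st₁ (turn[4+4m]≡-1 m) minus≥
  st₃ : Tracks (3 + base m) (+ (X + (X + Y)) , + X)
  st₃ = tracks-next st₂ (turn[5+4m]≡1 m) plus
  st₄ : Tracks (4 + base m) (+ (X + Y) , + (X + Y + X))
  st₄ = tracks-next st₃ (turn[6+4m]≡-1 m) minus≥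

negative-ratios : ∀ {m c r} → Tracks (base m) (pos² (swap (cf (suc c) r))) →
  turn (3 + m * 2 * 2) ≡ -1ℤ →
  ratio (1 + base m) ≡ cf c r × ratio (2 + base m) ≡ cf 1 (c ∷ r) ×
  ratio (3 + base m) ≡ cf 1 (1 ∷ c ∷ r) × Tracks (base (suc m)) (pos² (swap (cf 2 (c ∷ r))))
negative-ratios {m} {c} {r} st₀ turn≡-1 =
  trans (tracks-ratio st₁) (cong (_, Y) (∣-i∣≡∣i∣ (+ X))) ,
  trans (tracks-ratio st₂) (sym (cf-suc 0 (c ∷ r))) ,
  trans (tracks-ratio st₃) (sym (cf-1∷1∷ c r)) ,
  subst (Tracks _) (cong (pos² ∘ swap) (sym (cf-2∷ c r))) st₄
  where
  X Y : ℕ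
  X = proj₁ (cf c r)
  Y = proj₂ (cf c r)
  st₀′ : Tracks (base m) (+ Y , + (Y + X))
  st₀′ = subst (Tracks (base m)) (cong (pos² ∘ swap) (cf-suc c r)) st₀
  st₁ : Tracks (1 + base m) (ℤ.- + X , + Y)
  st₁ = tracks-next st₀′ turn≡-1 minus≤
  st₂ : Tracks (2 + base m) (+ (X + Y) , + X)
  st₂ = tracks-next st₁ (turn[4+4m]≡-1 m) (negate plus)
  st₃ : Tracks (3 + base m) (+ (X + Y + X) , + (X + Y))
  st₃ = tracks-next st₂ (turn[5+4m]≡1 m) plus
  st₄ : Tracks (4 + base m) (+ X , + (X + (X + Y)))
  st₄ = tracks-next st₃ (turn[6+4m]≡-1 m) minus≥

negative-block : ∀ {m c r} → Admissible c r → Tracks (base m) (pos² (swap (cf (suc c) r))) →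
                 turn (3 + m * 2 * 2) ≡ -1ℤ → BlockOutcome m
negative-block {m} {c} {r} (head-2-3 1≤c c≤2 ds) st₀ turn≡-1 =
  let ratio₁ , ratio₂ , ratio₃ , st₄ = negative-ratios {m} {c} {r} st₀ turn≡-1 in record
  { expansion₁ = expansion c r (≤-trans c≤2 (s≤s (s≤s z≤n))) ds ratio₁
  ; expansion₂ = expansion 1 (c ∷ r) (s≤s z≤n) (dc ∷ ds) ratio₂
  ; expansion₃ = expansion 1 (1 ∷ c ∷ r) (s≤s z≤n) (digit-1 ∷ dc ∷ ds) ratio₃
  ; next       = invariant (head-2-3 (s≤s z≤n) (s≤s z≤n) (dc ∷ ds)) st₄
  }
  where
  dc : Digit c
  dc = 1≤c , m≤n⇒m≤1+n c≤2
negative-block {m} (head-1-1 {r} ds) st₀ turn≡-1 =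
  let ratio₁ , ratio₂ , ratio₃ , st₄ = negative-ratios {m} {0} {1 ∷ r} st₀ turn≡-1 in record
  { expansion₁ = expansion 0 (1 ∷ r) z≤n (digit-1 ∷ ds) ratio₁
  ; expansion₂ = expansion 2 r (s≤s (s≤s z≤n)) ds (trans ratio₂ (cf-merge 1 1 r))
  ; expansion₃ = expansion 1 (2 ∷ r) (s≤s z≤n) (digit-2 ∷ ds) (trans ratio₃ (cf-merge-inner 1 1 1 r))
  ; next       = invariant (head-2-3 (s≤s z≤n) ≤-refl ds)
                   (subst (Tracks _) (cong (pos² ∘ swap) (cf-merge 2 1 r)) st₄)
  }

block : ∀ {m} → Invariant m → BlockOutcome m
block {m} (invariant adm st₀) with turn-sign (3 + m * 2 * 2)
... | inj₁ turn≡1  = positive-block adm st₀ turn≡1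
... | inj₂ turn≡-1 = negative-block adm st₀ turn≡-1

-- Block 1 starts from u = |h 6| / |h 7| = [2]; block 0 is excluded because h 3 = 0.
invariant-holds : ∀ m → Invariant (suc m)
invariant-holds zero    =
  invariant {c = 1} {r = []} (head-2-3 (s≤s z≤n) (s≤s z≤n) []) (tracks (signed -1ℤ (inj₂ refl) refl refl))
invariant-holds (suc m) = BlockOutcome.next (block (invariant-holds m))

block-expansion : ∀ m (j : Fin 4) → BoundedExpansion (toℕ j + base (suc m))
block-expansion m zero                   = invariant-expansion (invariant-holds m)
block-expansion m (suc zero)             = BlockOutcome.expansion₁ (block (invariant-holds m))
block-expansion m (suc (suc zero))       = BlockOutcome.expansion₂ (block (invariant-holds m))
block-expansion m (suc (suc (suc zero))) = BlockOutcome.expansion₃ (block (invariant-holds m))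

bounded-expansion : ∀ k → BoundedExpansion (4 + k)
bounded-expansion 0 = expansion 1 [] (s≤s z≤n) [] refl
bounded-expansion 1 = expansion 2 [] (s≤s (s≤s z≤n)) [] refl
bounded-expansion (suc (suc k)) with k divMod 4
... | result q j refl = subst BoundedExpansion (position (toℕ j) q) (block-expansion q j)
  where
  position : ∀ i q → i + (2 + suc q * 2 * 2) ≡ 6 + (i + q * 4)
  position = ℕ-Solver.solve-∀

theorem5 : (n : ℕ) → 5 ≤ n →
    ∣ h (n ∸ 1) ∣ ≢ 0 ×
    Σ ℕ (λ a → Σ (List ℕ) (λ εs →
      a ≤ 4 × All (λ e → 1 ≤ e × e ≤ 3) εs ×
      ∣ h n ∣ * proj₂ (cf a εs) ≡ proj₁ (cf a εs) * ∣ h (n ∸ 1) ∣))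
theorem5 (suc n) (s≤s 4≤n) with m≤n⇒∃[o]m+o≡n 4≤n
... | k , refl = expansion⇒cross-equation (bounded-expansion k)
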